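{- Let $\mathsf{Stages}=\{S,T\}$ and let $\mathcal{A}^\#$ be the $\mu$spec axiomatic semantics consisting of the two axioms $\forall i_1.\ \mathsf{hb}(i_1.S,i_1.T)$ and $\forall i_1,i_2.\ \mathsf{hb}(i_1.S,i_2.S)\Rightarrow \mathsf{hb}(i_1.T,i_2.T)$. Let $\mathcal{P}$ be a single-core program whose instruction stream has $m$ instructions. Then there is no operational model $\mathcal{M}=(\mathcal{Q},\Delta,q_{\mathsf{init}},q_{\mathsf{final}})$ that is sound and complete with respect to $\mathcal{A}^\#$ on the program $\mathcal{P}$ and whose number of control states satisfies $|\mathcal{Q}|<\mathcal{O}(2^m/m)$; this holds even when the history parameter is $h=\infty$. (That is, any such sound and complete model must have on the order of $2^m/m$ control states.)
   Context: Programming model: there are finitely many cores $\mathsf{Cores}=[n]$, each executing operations from a finite set $\mathbb{O}$. A program $\mathcal{P}$ is a family of finite words (instruction streams) $\mathcal{I}_c\in\mathbb{O}^*$, $c\in\mathsf{Cores}$. An instruction is a triple $(c,j,\mathcal{I}_c[j])$ with $0\le j<|\mathcal{I}_c|$; its core is $c$ and its label is $j$. $\mathsf{Instrs}(\mathcal{P})$ is the set of instructions of $\mathcal{P}$. For a finite set $\mathsf{Stages}$, events are pairs $i.\mathsf{st}$ (instruction $i$ performing stage $\mathsf{st}$); $\mathsf{Events}(\mathcal{P})=\{i.\mathsf{st}: i\in\mathsf{Instrs}(\mathcal{P}),\mathsf{st}\in\mathsf{Stages}\}$. A $\mu$hb graph for $\mathcal{P}$ is a directed acyclic graph $G=(V,E)$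 with $V=\mathsf{Events}(\mathcal{P})$; $\mathsf{hb}(e_1,e_2)$ is interpreted as $(e_1,e_2)\in E^+$ (transitive closure). An axiom is a first-order sentence with quantifiers over instruction variables and atoms $\mathsf{hb}(i_1.\mathsf{st}_1,i_2.\mathsf{st}_2)$, $i_1<_r i_2$ (same core and smaller label), and predicates on operations; quantifiers range over instructions of $\mathcal{P}$, with distinct variables assigned distinct instructions. $G\models_{\mathcal{P}}\mathcal{A}$ means $G$ satisfies all axioms of $\mathcal{A}$. A word $\sigma=e_1\cdots e_m$ of events is viewed as the linear graph $e_1\to e_2\to\cdots\to e_m$. Operational model: a tuple $(\mathcal{Q},\Delta,q_{\mathsf{init}},q_{\mathsf{final}})$ with finite control-state set $\mathcal{Q}$, initial state, absorbing final state, and history parameter $h\in\mathbb{N}\cup\{\infty\}$. It reads each core's instruction stream from a separate read-only tape with a one-way head; transitions are enabled by the current state and the instructions (or blank) under the heads, and perform an action: move a core's head right, do nothing, emit an event $i.\mathsf{st}$ for an instruction $i$ among those to the left of that core's head (identified by position, at most $h$), or drop such an instruction from the left part; configurations with more than $h$ instructions to the left of some head are disallowed. A run starts with the full streams to the right of the heads; it is accepting if it ends in $q_{\mathsf{final}}$; its trace is the sequence of emitted events; $\mathsf{Traces}(\mathcal{M},\mathcal{P})$ is the set of traces of accepting runs. $\mathcal{M}$ is sound w.r.t. $\mathcal{A}$ (on $\mathcal{P}$) if every trace in $\mathsf{Traces}(\mathcal{M},\mathcal{P})$ is a linearization (a total order of $V$ containing $E^+$) of some $\mu$hb graph $G$ with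 $G\models_{\mathcal{P}}\mathcal{A}$; it is complete if for every $G\models_{\mathcal{P}}\mathcal{A}$, $\mathsf{Traces}(\mathcal{M},\mathcal{P})$ contains all linearizations of $G$. -}

module Defs where

open import Data.Nat using (ℕ; zero; suc; _≤_; _<_)
open import Data.Fin using (Fin; _≟_)
import Data.Fin
open import Data.List using (List; []; _∷_; length; _++_; lookup)
open import Data.List.Membership.Propositional using (_∈_)
open import Data.List.Relation.Unary.Unique.Propositional using (Unique)
open import Data.Maybe using (Maybe; just; nothing)
import Data.Maybe as Maybe
open import Data.Bool using (if_then_else_)
open import Data.Unit using (⊤)
open import Data.Product using (Σ; _×_; _,_; ∃; ∃-syntax)
open import Relation.Binary.PropositionalEquality using (_≡_; _≢_)
open import Relation.Binary.Construct.Closure.Transitive using (TransClosure)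
open import Relation.Nullary using (¬_; does)

record Program (o : ℕ) : Set where
  field
    n       : ℕ
    stream  : Fin n → List (Fin o)

data Stage : Set where
  S T : Stage

module _ {o : ℕ} (P : Program o) where
  open Program P

  -- an instruction (c, j, 𝓘_c[j]) is determined by its core c and label j
  Instr : Set
  Instr = Σ (Fin n) (λ c → Fin (length (stream c)))

  Event : Set
  Event = Instr × Stage

module _ {o : ℕ} {P : Program o} where

  record μhbGraph : Set₁ where
    field
      E       : Event P → Event P → Set
      acyclic : ∀ e → ¬ TransClosure E e e

  hb : μhbGraph → Event P → Event P → Set
  hb G = TransClosure (μhbGraph.E G)

  -- G ⊨_P 𝓐#  (distinct variables range over distinct instructions)
  Sat𝓐# : μhbGraph → Set
  Sat𝓐# G =
    (∀ (i : Instr P) → hb G (i , S) (i , T)) ×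
    (∀ (i₁ i₂ : Instr P) → i₁ ≢ i₂ →
       hb G (i₁ , S) (i₂ , S) → hb G (i₁ , T) (i₂ , T))

  Before : List (Event P) → Event P → Event P → Set
  Before σ e₁ e₂ = ∃[ σ₁ ] ∃[ σ₂ ] (σ ≡ σ₁ ++ (e₁ ∷ σ₂)) × (e₂ ∈ σ₂)

  Linearization : μhbGraph → List (Event P) → Set
  Linearization G σ =
    (∀ e → e ∈ σ) × Unique σ × (∀ e₁ e₂ → hb G e₁ e₂ → Before σ e₁ e₂)

-- history parameter h ∈ ℕ ∪ {∞}; `nothing` is ∞
ℕ∞ : Set
ℕ∞ = Maybe ℕ

WithinH : ℕ∞ → ℕ → Set
WithinH nothing  _ = ⊤
WithinH (just h) l = l ≤ h

-- Actions. Positions in the left part are counted from the head: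
-- position 0 is the most recently read instruction still retained.
data Action (n : ℕ) : Set where
  move : Fin n → Action n
  nop  : Action n
  emit : Fin n → ℕ → Stage → Action n
  drop : Fin n → ℕ → Action n

at : {A : Set} → List A → ℕ → Maybe A
at []       _       = nothing
at (x ∷ xs) zero    = just x
at (x ∷ xs) (suc k) = at xs k

dropAt : {A : Set} → List A → ℕ → List A
dropAt []       _       = []
dropAt (x ∷ xs) zero    = xs
dropAt (x ∷ xs) (suc k) = x ∷ dropAt xs k

-- label under the head at position p (nothing = blank)
headAt : {A : Set} (xs : List A) → ℕ → Maybe (Fin (length xs))
headAt []       _       = nothing
headAt (x ∷ xs) zero    = just Data.Fin.zero
headAt (x ∷ xs) (suc p) = Maybe.map Data.Fin.suc (headAt xs p)

update : {n : ℕ} {A : Set} → (Fin n → A) → Fin n → A → Fin n → A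
update f c a c' = if does (c' ≟ c) then a else f c'

record OpModel (o n k : ℕ) : Set₁ where
  field
    Δ       : Fin k → (Fin n → Maybe (Fin o)) → Action n → Fin k → Set
    q-init  : Fin k
    q-final : Fin k
    h       : ℕ∞
    absorbing : ∀ s a q' → Δ q-final s a q' → q' ≡ q-final

module Semantics {o k : ℕ} (P : Program o) (M : OpModel o (Program.n P) k) where
  open Program P
  open OpModel M

  record Config : Set where
    constructor ⟨_,_,_⟩
    field
      state : Fin k
      pos   : Fin n → ℕ
      left  : Fin n → List (Instr P) -- retained instructions left of head
                                     -- (most recent first)

  symbols : Config → Fin n → Maybe (Fin o)
  symbols cfg c = Maybe.map (lookup (stream c)) (headAt (stream c) (Config.pos cfg c))

  Allowed : Config → Set
  Allowed cfg = ∀ c → WithinH h (length (Config.left cfg c))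

  data Step : Config → Maybe (Event P) → Config → Set where
    step-move : ∀ {q ps ls q' c j} →
      Δ q (symbols ⟨ q , ps , ls ⟩) (move c) q' →
      headAt (stream c) (ps c) ≡ just j →
      Allowed ⟨ q' , update ps c (suc (ps c)) , update ls c ((c , j) ∷ ls c) ⟩ →
      Step ⟨ q , ps , ls ⟩ nothing
           ⟨ q' , update ps c (suc (ps c)) , update ls c ((c , j) ∷ ls c) ⟩
    step-nop : ∀ {q ps ls q'} →
      Δ q (symbols ⟨ q , ps , ls ⟩) nop q' →
      Allowed ⟨ q' , ps , ls ⟩ →
      Step ⟨ q , ps , ls ⟩ nothing ⟨ q' , ps , ls ⟩
    step-emit : ∀ {q ps ls q' c p st i} →
      Δ q (symbols ⟨ q , ps , ls ⟩) (emit c p st) q' →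
      at (ls c) p ≡ just i →
      Allowed ⟨ q' , ps , ls ⟩ →
      Step ⟨ q , ps , ls ⟩ (just (i , st)) ⟨ q' , ps , ls ⟩
    step-drop : ∀ {q ps ls q' c p} →
      Δ q (symbols ⟨ q , ps , ls ⟩) (drop c p) q' →
      p < length (ls c) →
      Allowed ⟨ q' , ps , update ls c (dropAt (ls c) p) ⟩ →
      Step ⟨ q , ps , ls ⟩ nothing ⟨ q' , ps , update ls c (dropAt (ls c) p) ⟩

  emitted : Maybe (Event P) → List (Event P) → List (Event P)
  emitted nothing  t = t
  emitted (just e) t = e ∷ t

  data Run : Config → List (Event P) → Config → Set where
    done : ∀ {c} → Run c [] c
    _▸_  : ∀ {c₁ me c₂ t c₃} → Step c₁ me c₂ → Run c₂ t c₃ →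
           Run c₁ (emitted me t) c₃

  init : Config
  init = ⟨ q-init , (λ _ → 0) , (λ _ → []) ⟩

  IsTrace : List (Event P) → Set
  IsTrace σ = ∃[ cfg ] Run init σ cfg × (Config.state cfg ≡ q-final)

  Sound : Set₁
  Sound = ∀ σ → IsTrace σ → ∃[ G ] Sat𝓐# {P = P} G × Linearization G σ

  Complete : Set₁
  Complete = ∀ (G : μhbGraph {P = P}) → Sat𝓐# G →
             ∀ σ → Linearization G σ → IsTrace σ

singleCore : {o : ℕ} → List (Fin o) → Program o
singleCore ops = record { n = 1 ; stream = λ _ → ops }

-- The graph whose only edges are i.S → i.T satisfies 𝓐#, and for every subset X of
-- the m instructions the word listing the S-events of X, then the other S-events, then all
-- T-events is one of its linearizations; completeness yields an accepting run on each of these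
-- 2^m words. Cut such a run after the S-events of X. Every instruction read so far still has its
-- T-event pending, so it is still retained, and retained instructions stay sorted by label: the
-- configuration at the cut is determined by the control state and the number of instructions
-- read, at most k(m+1) possibilities. If 2^m > k(m+1), two subsets X ≠ Y share it, and grafting
-- the second half of Y's run onto the first half of X's gives an accepted trace in which some
-- S-event is missing or repeated, contradicting soundness.
module Submission where

open import Defs
open import Data.Nat using (ℕ; _≤_; _*_; _^_)
open import Data.Fin using (Fin)
open import Data.List using (List; length)
open import Data.Product using (∃-syntax)

open import Data.Nat using (zero; suc; _+_; _<_; _>_; z≤n; s≤s)
import Data.Nat.Properties as ℕ
open import Data.Fin as Fin using (toℕ; combine; fromℕ<; finToFun; funToFin)
import Data.Fin.Properties as Fin
open import Data.List using ([]; _∷_; _++_; map; filter; allFin)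
open import Data.List.Properties using (++-assoc)
open import Data.List.Membership.Propositional using (_∈_; _∉_)
open import Data.List.Membership.Propositional.Properties
open import Data.List.Relation.Unary.Any using (here; there)
open import Data.List.Relation.Unary.All as All using (All; []; _∷_)
open import Data.List.Relation.Unary.AllPairs using (AllPairs; []; _∷_)
open import Data.List.Relation.Unary.Unique.Propositional using (Unique)
import Data.List.Relation.Unary.Unique.Propositional.Properties as Unique
open import Data.List.Relation.Binary.Sublist.Propositional using (_⊆_; []; _∷_; _∷ʳ_; ⊆-refl)
open import Data.List.Relation.Binary.Sublist.Propositional.Properties using (All-resp-⊆; Any-resp-⊆)
open import Data.Maybe using (just; nothing)
open import Data.Product using (_×_; _,_; proj₁; proj₂; ∃)
open import Data.Sum using (_⊎_; inj₁; inj₂)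
open import Data.Empty using (⊥-elim)
open import Function using (_on_)
open import Relation.Nullary using (¬_)
open import Relation.Binary.Definitions using (Asymmetric)
open import Relation.Binary.PropositionalEquality
open import Relation.Binary.Construct.Closure.Transitive using (TransClosure; [_]; _∷_)

at-∈ : ∀ {A : Set} (xs : List A) p {x} → at xs p ≡ just x → x ∈ xs
at-∈ (y ∷ xs) zero    refl = here refl
at-∈ (y ∷ xs) (suc p) e    = there (at-∈ xs p e)

dropAt-⊆ : ∀ {A : Set} (xs : List A) p → dropAt xs p ⊆ xs
dropAt-⊆ []       p       = []
dropAt-⊆ (x ∷ xs) zero    = x ∷ʳ ⊆-refl
dropAt-⊆ (x ∷ xs) (suc p) = refl ∷ dropAt-⊆ xs p

headAt-toℕ : ∀ {A : Set} (xs : List A) p {j} → headAt xs p ≡ just j → toℕ j ≡ p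
headAt-toℕ (x ∷ xs) zero    refl = refl
headAt-toℕ (x ∷ xs) (suc p) e with headAt xs p in eq
headAt-toℕ (x ∷ xs) (suc p) refl | just j = cong suc (headAt-toℕ xs p eq)

AllPairs-resp-⊇ : ∀ {A : Set} {R : A → A → Set} {xs ys} → xs ⊆ ys → AllPairs R ys → AllPairs R xs
AllPairs-resp-⊇ []           []       = []
AllPairs-resp-⊇ (y ∷ʳ sub)   (_ ∷ ys) = AllPairs-resp-⊇ sub ys
AllPairs-resp-⊇ (refl ∷ sub) (y ∷ ys) = All-resp-⊆ sub y ∷ AllPairs-resp-⊇ sub ys

Unique-++-disjoint : ∀ {A : Set} (xs : List A) {ys x} → Unique (xs ++ ys) → x ∈ xs → x ∉ ys
Unique-++-disjoint (y ∷ xs) (y∉ ∷ _) (here refl) x∈ys = All.lookup y∉ (∈-++⁺ʳ xs x∈ys) refl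
Unique-++-disjoint (y ∷ xs) (_ ∷ u) (there x∈xs) x∈ys = Unique-++-disjoint xs u x∈xs x∈ys

AllPairs-asym-≡ : ∀ {A : Set} {R : A → A → Set} → Asymmetric R → ∀ {xs ys} →
                  AllPairs R xs → AllPairs R ys →
                  (∀ {z} → z ∈ xs → z ∈ ys) → (∀ {z} → z ∈ ys → z ∈ xs) → xs ≡ ys
AllPairs-asym-≡ asym [] [] _ _ = refl
AllPairs-asym-≡ asym [] (_ ∷ _) _ ys⊆ with () ← ys⊆ (here refl)
AllPairs-asym-≡ asym (_ ∷ _) [] xs⊆ _ with () ← xs⊆ (here refl)
AllPairs-asym-≡ {R = R} asym {x ∷ xs} {y ∷ ys} (Rx ∷ sx) (Ry ∷ sy) xs⊆ ys⊆ with heads≡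
  where
    heads≡ : x ≡ y
    heads≡ with xs⊆ (here refl) | ys⊆ (here refl)
    ... | here x≡y | _         = x≡y
    ... | there _  | here y≡x  = sym y≡x
    ... | there x∈ | there y∈  = ⊥-elim (asym (All.lookup Ry x∈) (All.lookup Rx y∈))
... | refl = cong (x ∷_) (AllPairs-asym-≡ asym sx sy (tail Rx xs⊆) (tail Ry ys⊆))
  where
    tail : ∀ {zs ws} → All (R x) zs → (∀ {z} → z ∈ x ∷ zs → z ∈ x ∷ ws) →
           ∀ {z} → z ∈ zs → z ∈ ws
    tail Rx zs⊆ z∈ with zs⊆ (there z∈)
    ... | there z∈ws = z∈ws
    ... | here refl  = ⊥-elim (asym (All.lookup Rx z∈) (All.lookup Rx z∈))

funToFin-cong : ∀ {m n} {f g : Fin m → Fin n} → f ≗ g → funToFin f ≡ funToFin g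
funToFin-cong {zero}  f≗g = refl
funToFin-cong {suc m} f≗g = cong₂ combine (f≗g Fin.zero) (funToFin-cong (λ j → f≗g (Fin.suc j)))

finToFun-injective : ∀ {m n} {a b : Fin (n ^ m)} →
                     finToFun {n} {m} a ≗ finToFun b → a ≡ b
finToFun-injective {m} {n} {a} {b} a≗b = begin
  a                              ≡⟨ Fin.funToFin-finToFin {m} {n} a ⟨
  funToFin {m} {n} (finToFun a)  ≡⟨ funToFin-cong {m} {n} a≗b ⟩
  funToFin {m} {n} (finToFun b)  ≡⟨ Fin.funToFin-finToFin {m} {n} b ⟩
  b                              ∎
  where open ≡-Reasoning

module SingleCore {o : ℕ} (ops : List (Fin o)) where

  m : ℕ
  m = length ops

  P : Program o
  P = singleCore ops

  lab : Instr P → ℕ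
  lab (_ , j) = toℕ j

  evS evT : Fin m → Event P
  evS j = (Fin.zero , j) , S
  evT j = (Fin.zero , j) , T

  evS-injective : ∀ {i j} → evS i ≡ evS j → i ≡ j
  evS-injective refl = refl

  evT-injective : ∀ {i j} → evT i ≡ evT j → i ≡ j
  evT-injective refl = refl

  data Edge : Event P → Event P → Set where
    edge : ∀ i → Edge (i , S) (i , T)

  -- Paths have length one, since no edge leaves a T-event.
  Edge⁺⇒Edge : ∀ {e₁ e₂} → TransClosure Edge e₁ e₂ → Edge e₁ e₂
  Edge⁺⇒Edge [ e ] = e
  Edge⁺⇒Edge (edge i ∷ [ () ])
  Edge⁺⇒Edge (edge i ∷ (() ∷ _))

  G : μhbGraph {P = P}
  G = record { E = Edge ; acyclic = λ e cycle → irreflexive (Edge⁺⇒Edge cycle) }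
    where
      irreflexive : ∀ {e} → ¬ Edge e e
      irreflexive ()

  G⊨𝓐# : Sat𝓐# G
  G⊨𝓐# = (λ i → [ edge i ]) , λ i₁ i₂ _ S→S → ⊥-elim (noS→S (Edge⁺⇒Edge S→S))
    where
      noS→S : ∀ {i₁ i₂} → ¬ Edge (i₁ , S) (i₂ , S)
      noS→S ()

  block : Fin 2 → (Fin m → Fin 2) → List (Event P)
  block b X = map evS (filter (λ j → X j Fin.≟ b) (allFin m))

  Ts : List (Event P)
  Ts = map evT (allFin m)

  splice : (X Y : Fin m → Fin 2) → List (Event P)
  splice X Y = block Fin.zero X ++ block (Fin.suc Fin.zero) Y ++ Ts

  ∈-block⁺ : ∀ b X j → X j ≡ b → evS j ∈ block b X
  ∈-block⁺ b X j Xj≡b = ∈-map⁺ evS (∈-filter⁺ (λ j → X j Fin.≟ b) (∈-allFin j) Xj≡b)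

  ∈-block⁻ : ∀ b X {e} → e ∈ block b X → ∃ λ j → e ≡ evS j × X j ≡ b
  ∈-block⁻ b X e∈ with j , j∈ , refl ← ∈-map⁻ evS e∈ =
    j , refl , proj₂ (∈-filter⁻ (λ j → X j Fin.≟ b) {xs = allFin m} j∈)

  evS∉Ts : ∀ j → evS j ∉ Ts
  evS∉Ts j e∈ with _ , _ , () ← ∈-map⁻ evT e∈

  Unique-block : ∀ b X → Unique (block b X)
  Unique-block b X = Unique.map⁺ evS-injective (Unique.filter⁺ (λ j → X j Fin.≟ b) (Unique.allFin⁺ m))

  ∈-block⇒ : ∀ {b X j} → evS j ∈ block b X → X j ≡ b
  ∈-block⇒ {b} {X} e∈ with ∈-block⁻ b X e∈
  ... | _ , e≡ , Xj≡b with refl ← evS-injective e≡ = Xj≡b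

  evS∈blocks : ∀ X j → evS j ∈ block Fin.zero X ⊎ evS j ∈ block (Fin.suc Fin.zero) X
  evS∈blocks X j with X j in Xj
  ... | Fin.zero          = inj₁ (∈-block⁺ _ X j Xj)
  ... | Fin.suc Fin.zero  = inj₂ (∈-block⁺ _ X j Xj)

  evT∈Ts : ∀ j → evT j ∈ Ts
  evT∈Ts j = ∈-map⁺ evT (∈-allFin j)

  before-++ : ∀ {xs ys : List (Event P)} {x y} → x ∈ xs → y ∈ ys → Before {P = P} (xs ++ ys) x y
  before-++ {ys = ys} x∈xs y∈ys with ws , zs , refl ← ∈-∃++ x∈xs =
    ws , zs ++ ys , ++-assoc ws (_ ∷ zs) ys , ∈-++⁺ʳ zs y∈ys

  before-++ʳ : ∀ xs {ys : List (Event P)} {x y} → Before {P = P} ys x y → Before {P = P} (xs ++ ys) x y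
  before-++ʳ xs (σ₁ , σ₂ , refl , y∈σ₂) = xs ++ σ₁ , σ₂ , sym (++-assoc xs σ₁ _) , y∈σ₂

  splice-linearization : ∀ X → Linearization G (splice X X)
  splice-linearization X = covers , unique , ordered
    where
      B₀ B₁ : List (Event P)
      B₀ = block Fin.zero X
      B₁ = block (Fin.suc Fin.zero) X

      covers : ∀ e → e ∈ splice X X
      covers ((Fin.zero , j) , S) with evS∈blocks X j
      ... | inj₁ e∈B₀ = ∈-++⁺ˡ e∈B₀
      ... | inj₂ e∈B₁ = ∈-++⁺ʳ B₀ (∈-++⁺ˡ e∈B₁)
      covers ((Fin.zero , j) , T) = ∈-++⁺ʳ B₀ (∈-++⁺ʳ B₁ (evT∈Ts j))

      blocks-disjoint : ∀ {e} → ¬ (e ∈ B₀ × e ∈ B₁)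
      blocks-disjoint (e∈B₀ , e∈B₁) with j , refl , Xj≡1 ← ∈-block⁻ _ X e∈B₁ =
        Fin.0≢1+n (trans (sym (∈-block⇒ e∈B₀)) Xj≡1)

      block-Ts-disjoint : ∀ b {e} → ¬ (e ∈ block b X × e ∈ Ts)
      block-Ts-disjoint b (e∈B , e∈Ts) with j , refl , _ ← ∈-block⁻ b X e∈B = evS∉Ts j e∈Ts

      B₀-rest-disjoint : ∀ {e} → ¬ (e ∈ B₀ × e ∈ B₁ ++ Ts)
      B₀-rest-disjoint (e∈B₀ , e∈rest) with ∈-++⁻ B₁ e∈rest
      ... | inj₁ e∈B₁ = blocks-disjoint (e∈B₀ , e∈B₁)
      ... | inj₂ e∈Ts = block-Ts-disjoint _ (e∈B₀ , e∈Ts)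

      unique : Unique (splice X X)
      unique = Unique.++⁺ (Unique-block _ X)
                 (Unique.++⁺ (Unique-block _ X) (Unique.map⁺ evT-injective (Unique.allFin⁺ m))
                   (block-Ts-disjoint _))
                 B₀-rest-disjoint

      ordered : ∀ e₁ e₂ → hb G e₁ e₂ → Before {P = P} (splice X X) e₁ e₂
      ordered _ _ e₁≺e₂ with Edge⁺⇒Edge e₁≺e₂
      ... | edge (Fin.zero , j) with evS∈blocks X j
      ...   | inj₁ e∈B₀ = before-++ e∈B₀ (∈-++⁺ʳ B₁ (evT∈Ts j))
      ...   | inj₂ e∈B₁ = before-++ʳ B₀ (before-++ e∈B₁ (evT∈Ts j))

  splice-agrees : ∀ X Y → (∀ e → e ∈ splice X Y) → Unique (splice X Y) → X ≗ Y
  splice-agrees X Y covers unique j with X j in Xj | Y j in Yj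
  ... | Fin.zero         | Fin.zero         = refl
  ... | Fin.suc Fin.zero | Fin.suc Fin.zero = refl
  ... | Fin.zero         | Fin.suc Fin.zero =
    ⊥-elim (Unique-++-disjoint (block _ X) unique (∈-block⁺ _ X j Xj) (∈-++⁺ˡ (∈-block⁺ _ Y j Yj)))
  ... | Fin.suc Fin.zero | Fin.zero with ∈-++⁻ (block _ X) (covers (evS j))
  ...   | inj₁ e∈X₀ = ⊥-elim (Fin.0≢1+n (trans (sym (∈-block⇒ e∈X₀)) Xj))
  ...   | inj₂ e∈rest with ∈-++⁻ (block _ Y) e∈rest
  ...     | inj₁ e∈Y₁ = ⊥-elim (Fin.0≢1+n (trans (sym Yj) (∈-block⇒ e∈Y₁)))
  ...     | inj₂ e∈Ts = ⊥-elim (evS∉Ts j e∈Ts)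

  -- The head positions after reading p instructions, built with the same `update` as the steps,
  -- so that reachable head positions are equal as functions (not just pointwise).
  headsAt : ℕ → Fin 1 → ℕ
  headsAt zero    = λ _ → 0
  headsAt (suc p) = update (headsAt p) Fin.zero (suc (headsAt p Fin.zero))

  headsAt-zero : ∀ p → headsAt p Fin.zero ≡ p
  headsAt-zero zero    = refl
  headsAt-zero (suc p) = cong suc (headsAt-zero p)

  module Runs {k : ℕ} (M : OpModel o 1 k) where
    open Semantics P M

    retained : Config → List (Instr P)
    retained c = Config.left c Fin.zero

    record Shape (pos : Fin 1 → ℕ) (left : List (Instr P)) : Set where
      field
        read          : ℕ
        read≤m        : read ≤ m
        pos≡headsAt   : pos ≡ headsAt read
        descending    : AllPairs (_>_ on lab) left
        retained<read : All (λ i → lab i < read) left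

    WellFormed : Config → Set
    WellFormed c = Shape (Config.pos c) (retained c)

    WellFormed-init : WellFormed init
    WellFormed-init = record
      { read = 0 ; read≤m = z≤n ; pos≡headsAt = refl ; descending = [] ; retained<read = [] }

    WellFormed-step : ∀ {c e c'} → Step c e c' → WellFormed c → WellFormed c'
    WellFormed-step (step-move {c = Fin.zero} {j = j} _ j-under-head _) wf = record
      { read = suc read
      ; read≤m = subst (λ r → suc r ≤ m) j≡read (Fin.toℕ<n j)
      ; pos≡headsAt = cong (λ ps → update ps Fin.zero (suc (ps Fin.zero))) pos≡headsAt
      ; descending = All.map (subst (_ <_) (sym j≡read)) retained<read ∷ descending
      ; retained<read = ℕ.≤-reflexive (cong suc j≡read) ∷ All.map ℕ.m<n⇒m<1+n retained<read
      }
      where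
        open Shape wf
        j≡read : toℕ j ≡ read
        j≡read = trans (headAt-toℕ ops _ j-under-head)
                       (trans (cong (λ ps → ps Fin.zero) pos≡headsAt) (headsAt-zero read))
    WellFormed-step (step-nop _ _)    wf = wf
    WellFormed-step (step-emit _ _ _) wf = wf
    WellFormed-step (step-drop {ls = ls} {c = Fin.zero} {p = p} _ _ _) wf = record
      { read = read ; read≤m = read≤m ; pos≡headsAt = pos≡headsAt
      ; descending = AllPairs-resp-⊇ (dropAt-⊆ (ls Fin.zero) p) descending
      ; retained<read = All-resp-⊆ (dropAt-⊆ (ls Fin.zero) p) retained<read
      }
      where open Shape wf

    WellFormed-run : ∀ {c t c'} → Run c t c' → WellFormed c → WellFormed c'
    WellFormed-run done      wf = wf
    WellFormed-run (s ▸ run) wf = WellFormed-run run (WellFormed-step s wf)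

    -- A necessary condition for emitting an event of i later from c.
    Emittable : Config → Instr P → Set
    Emittable c i = i ∈ retained c ⊎ Config.pos c Fin.zero ≤ lab i

    Emittable-step : ∀ {c e c' i} → Step c e c' → Emittable c' i → Emittable c i
    Emittable-step (step-move {c = Fin.zero} _ j-under-head _) (inj₁ (here refl)) =
      inj₂ (ℕ.≤-reflexive (sym (headAt-toℕ ops _ j-under-head)))
    Emittable-step (step-move {c = Fin.zero} _ _ _) (inj₁ (there i∈)) = inj₁ i∈
    Emittable-step (step-move {c = Fin.zero} _ _ _) (inj₂ pos<i)      = inj₂ (ℕ.<⇒≤ pos<i)
    Emittable-step (step-nop _ _)    emittable = emittable
    Emittable-step (step-emit _ _ _) emittable = emittable
    Emittable-step (step-drop {ls = ls} {c = Fin.zero} {p = p} _ _ _) (inj₁ i∈) =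
      inj₁ (Any-resp-⊆ (dropAt-⊆ (ls Fin.zero) p) i∈)
    Emittable-step (step-drop {c = Fin.zero} _ _ _) (inj₂ pos≤i) = inj₂ pos≤i

    emitted⇒Emittable : ∀ {c t c' i st} → Run c t c' → (i , st) ∈ t → Emittable c i
    emitted⇒Emittable (_▸_ {me = nothing} s run) e∈ = Emittable-step s (emitted⇒Emittable run e∈)
    emitted⇒Emittable (_▸_ {me = just _} s run) (there e∈) =
      Emittable-step s (emitted⇒Emittable run e∈)
    emitted⇒Emittable (_▸_ {me = just _} (step-emit {ls = ls} {c = Fin.zero} {p = p} _ i-at-p _) _)
                      (here refl) = inj₁ (at-∈ (ls Fin.zero) p i-at-p)

    Run-++ : ∀ {c₁ u c₂ v c₃} → Run c₁ u c₂ → Run c₂ v c₃ → Run c₁ (u ++ v) c₃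
    Run-++ done                   run₂ = run₂
    Run-++ (_▸_ {me = nothing} s run₁) run₂ = s ▸ Run-++ run₁ run₂
    Run-++ (_▸_ {me = just _} s run₁)  run₂ = s ▸ Run-++ run₁ run₂

    Run-split : ∀ {c t c'} → Run c t c' → ∀ u {v} → t ≡ u ++ v →
                ∃ λ c₂ → Run c u c₂ × Run c₂ v c'
    Run-split run [] refl = _ , done , run
    Run-split (_▸_ {me = nothing} s run) u t≡ with c₂ , run₁ , run₂ ← Run-split run u t≡ =
      c₂ , s ▸ run₁ , run₂
    Run-split (_▸_ {me = just _} s run) (_ ∷ u) refl with c₂ , run₁ , run₂ ← Run-split run u refl =
      c₂ , s ▸ run₁ , run₂

    Allowed-cong : ∀ {q ps ls ls'} → ls Fin.zero ≡ ls' Fin.zero →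
                   Allowed ⟨ q , ps , ls ⟩ → Allowed ⟨ q , ps , ls' ⟩
    Allowed-cong ls≡ allowed Fin.zero =
      subst (λ l → WithinH (OpModel.h M) (length l)) ls≡ (allowed Fin.zero)

    -- `left` is a function on cores; without function extensionality we transport steps along
    -- equality of its value at the single core.
    Step-cong-left : ∀ {c e c'} → Step c e c' → ∀ ls → retained c ≡ ls Fin.zero →
                     ∃ λ ls' → Step ⟨ Config.state c , Config.pos c , ls ⟩ e
                                    ⟨ Config.state c' , Config.pos c' , ls' ⟩ ×
                               retained c' ≡ ls' Fin.zero
    Step-cong-left {⟨ q , ps , ls ⟩}
                   (step-move {q' = q'} {c = Fin.zero} {j = j} δ j-under-head allowed) ls' ≡ls' =
      update ls' Fin.zero ((Fin.zero , j) ∷ ls' Fin.zero) ,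
      step-move {q' = q'} {c = Fin.zero} {j = j} δ j-under-head
        (Allowed-cong {q'} {update ps Fin.zero (suc (ps Fin.zero))}
           {update ls Fin.zero ((Fin.zero , j) ∷ ls Fin.zero)}
           {update ls' Fin.zero ((Fin.zero , j) ∷ ls' Fin.zero)} (cong ((Fin.zero , j) ∷_) ≡ls') allowed) ,
      cong ((Fin.zero , j) ∷_) ≡ls'
    Step-cong-left {⟨ q , ps , ls ⟩} (step-nop {q' = q'} δ allowed) ls' ≡ls' =
      ls' , step-nop δ (Allowed-cong {q'} {ps} {ls} {ls'} ≡ls' allowed) , ≡ls'
    Step-cong-left {⟨ q , ps , ls ⟩}
                   (step-emit {q' = q'} {c = Fin.zero} {p = p} {i = i} δ i-at-p allowed) ls' ≡ls' =
      ls' , step-emit {c = Fin.zero} {p = p} δ (subst (λ l → at l p ≡ just i) ≡ls' i-at-p)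
              (Allowed-cong {q'} {ps} {ls} {ls'} ≡ls' allowed) ,
      ≡ls'
    Step-cong-left {⟨ q , ps , ls ⟩} (step-drop {q' = q'} {c = Fin.zero} {p = p} δ p<len allowed) ls' ≡ls' =
      update ls' Fin.zero (dropAt (ls' Fin.zero) p) ,
      step-drop {c = Fin.zero} {p = p} δ (subst (λ l → p < length l) ≡ls' p<len)
        (Allowed-cong {q'} {ps} {update ls Fin.zero (dropAt (ls Fin.zero) p)}
           {update ls' Fin.zero (dropAt (ls' Fin.zero) p)}
           (cong (λ l → dropAt l p) ≡ls') allowed) ,
      cong (λ l → dropAt l p) ≡ls'

    Run-cong-left : ∀ {c t c'} → Run c t c' → ∀ ls → retained c ≡ ls Fin.zero →
                    ∃ λ d → Run ⟨ Config.state c , Config.pos c , ls ⟩ t d ×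
                            Config.state d ≡ Config.state c'
    Run-cong-left done ls ≡ls = _ , done , refl
    Run-cong-left (s ▸ run) ls ≡ls with ls' , s' , ≡ls' ← Step-cong-left s ls ≡ls
                                  with d , run' , state≡ ← Run-cong-left run ls' ≡ls' =
      d , s' ▸ run' , state≡

    Run-transfer : ∀ {c₁ t c₁' c} → Run c₁ t c₁' →
                   Config.state c₁ ≡ Config.state c → Config.pos c₁ ≡ Config.pos c →
                   retained c₁ ≡ retained c →
                   ∃ λ c' → Run c t c' × Config.state c' ≡ Config.state c₁'
    Run-transfer {c = c} run state≡ pos≡ retained≡
      with c' , run' , state'≡ ← Run-cong-left run (Config.left c) retained≡ =
      c' , subst₂ (λ q ps → Run ⟨ q , ps , Config.left c ⟩ _ c') state≡ pos≡ run' , state'≡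

    read⇒retained : ∀ {c t c'} → Run c t c' → (shape : WellFormed c) →
                    ∀ j → evT j ∈ t → toℕ j < Shape.read shape → (Fin.zero , j) ∈ retained c
    read⇒retained {c} run shape j T∈t j<read with emitted⇒Emittable run T∈t
    ... | inj₁ retained = retained
    ... | inj₂ read≤j = ⊥-elim (ℕ.<⇒≱ j<read (subst (_≤ toℕ j) pos≡read read≤j))
      where
        pos≡read : Config.pos c Fin.zero ≡ Shape.read shape
        pos≡read = trans (cong (λ ps → ps Fin.zero) (Shape.pos≡headsAt shape)) (headsAt-zero _)

  module LowerBound {k : ℕ} (M : OpModel o 1 k)
                    (sound : Semantics.Sound P M) (complete : Semantics.Complete P M) where
    open Semantics P M
    open Runs M

    record Cut (X : Fin m → Fin 2) : Set where
      field
        mid end : Config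
        prefix  : Run init (block Fin.zero X) mid
        suffix  : Run mid (block (Fin.suc Fin.zero) X ++ Ts) end
        accepts : Config.state end ≡ OpModel.q-final M
        shape   : WellFormed mid
      open Shape shape public

    cut : ∀ X → Cut X
    cut X with end , run , accepts ← complete G G⊨𝓐# (splice X X) (splice-linearization X)
          with mid , prefix , suffix ← Run-split run (block Fin.zero X) refl = record
      { prefix = prefix ; suffix = suffix ; accepts = accepts
      ; shape = WellFormed-run prefix WellFormed-init }

    retained-cut : ∀ X Y → Cut.read (cut X) ≡ Cut.read (cut Y) →
                   retained (Cut.mid (cut X)) ≡ retained (Cut.mid (cut Y))
    retained-cut X Y read≡ =
      AllPairs-asym-≡ ℕ.<-asym (Cut.descending (cut X)) (Cut.descending (cut Y))
        (X⊆Y X Y read≡) (X⊆Y Y X (sym read≡))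
      where
        X⊆Y : ∀ X Y → Cut.read (cut X) ≡ Cut.read (cut Y) →
              ∀ {i} → i ∈ retained (Cut.mid (cut X)) → i ∈ retained (Cut.mid (cut Y))
        X⊆Y X Y read≡ {Fin.zero , j} i∈ =
          read⇒retained (Cut.suffix (cut Y)) (Cut.shape (cut Y)) j
            (∈-++⁺ʳ (block _ Y) (evT∈Ts j))
            (subst (toℕ j <_) read≡ (All.lookup (Cut.retained<read (cut X)) i∈))

    code : Fin (2 ^ m) → Fin (k * suc m)
    code a = combine (Config.state (Cut.mid c)) (fromℕ< (s≤s (Cut.read≤m c)))
      where
        c : Cut (finToFun a)
        c = cut (finToFun a)

    code-injective : ∀ a b → code a ≡ code b → a ≡ b
    code-injective a b code≡ = finToFun-injective (splice-agrees X Y covers unique)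
      where
        X Y : Fin m → Fin 2
        X = finToFun a
        Y = finToFun b
        open Cut (cut X) using ()
          renaming (mid to midX; prefix to prefixX; read to readX; read≤m to readX≤m; pos≡headsAt to posX≡)
        open Cut (cut Y) using ()
          renaming (mid to midY; suffix to suffixY; accepts to acceptsY; read to readY; read≤m to readY≤m;
                    pos≡headsAt to posY≡)
        parts≡ : Config.state midX ≡ Config.state midY ×
                 fromℕ< (s≤s readX≤m) ≡ fromℕ< (s≤s readY≤m)
        parts≡ = Fin.combine-injective (Config.state midX) (fromℕ< (s≤s readX≤m))
                                       (Config.state midY) (fromℕ< (s≤s readY≤m)) code≡
        state≡ : Config.state midY ≡ Config.state midX
        state≡ = sym (proj₁ parts≡)
        read≡ : readX ≡ readY
        read≡ = begin
          readX                       ≡⟨ Fin.toℕ-fromℕ< (s≤s readX≤m) ⟨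
          toℕ (fromℕ< (s≤s readX≤m))  ≡⟨ cong toℕ (proj₂ parts≡) ⟩
          toℕ (fromℕ< (s≤s readY≤m))  ≡⟨ Fin.toℕ-fromℕ< (s≤s readY≤m) ⟩
          readY                       ∎
          where open ≡-Reasoning
        pos≡ : Config.pos midY ≡ Config.pos midX
        pos≡ = trans posY≡ (trans (cong headsAt (sym read≡)) (sym posX≡))
        spliced : IsTrace (splice X Y)
        spliced with end , suffix , state≡'
                       ← Run-transfer suffixY state≡ pos≡ (retained-cut Y X (sym read≡)) =
          end , Run-++ prefixX suffix , trans state≡' acceptsY
        covers : ∀ e → e ∈ splice X Y
        covers = proj₁ (proj₂ (proj₂ (sound _ spliced)))
        unique : Unique (splice X Y)
        unique = proj₁ (proj₂ (proj₂ (proj₂ (sound _ spliced))))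

    bound : 2 ^ m ≤ k * suc m
    bound = ℕ.≮⇒≥ λ k*[1+m]<2^m →
      let i , j , i<j , codes≡ = Fin.pigeonhole k*[1+m]<2^m code
      in  Fin.<⇒≢ i<j (code-injective i j codes≡)

*-suc-≤-2* : ∀ {m} k → 1 ≤ m → k * suc m ≤ 2 * m * k
*-suc-≤-2* {m} k 1≤m = begin
  k * suc m    ≤⟨ ℕ.*-monoʳ-≤ k (ℕ.+-monoˡ-≤ m 1≤m) ⟩
  k * (m + m)  ≡⟨ cong (λ n → k * (m + n)) (ℕ.+-identityʳ m) ⟨
  k * (2 * m)  ≡⟨ ℕ.*-comm k (2 * m) ⟩
  2 * m * k    ∎
  where open ℕ.≤-Reasoning

theorem1 : ∃[ C ] ∃[ m₀ ] (∀ (o : ℕ) (ops : List (Fin o)) → m₀ ≤ length ops →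
    ∀ (k : ℕ) (M : OpModel o 1 k) →
    Semantics.Sound (singleCore ops) M → Semantics.Complete (singleCore ops) M →
    2 ^ length ops ≤ C * length ops * k)
theorem1 = 2 , 1 , λ o ops 1≤m k M sound complete →
  ℕ.≤-trans (SingleCore.LowerBound.bound ops M sound complete) (*-suc-≤-2* k 1≤m)
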